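{- Let $\mathcal T$ be a basic theory and $\zeta\Rightarrow_r\eta$ a graded implication. If there is a forest proof of $\zeta\Rightarrow_r\eta$ from $\mathcal T$, then there is a forest proof of $\zeta\Rightarrow_r\eta$ from $\mathcal T$ in which no proper node contains an unused literal.
   Context: Boolean formulas are built from countably many variables and $\bot,\top$ via $\wedge,\vee,\neg$; $\alpha,\beta$ are Boolean equivalent if $\alpha\to\beta$ and $\beta\to\alpha$ are classical tautologies. A graded implication is $\alpha\Rightarrow_d\beta$, $d\in\mathbb R^+=[0,\infty)$. A literal is $\phi$ or $\neg\phi$ for a variable $\phi$; a clause is a finite set of literals, inconsistent if it contains some $\phi$ and $\neg\phi$, consistent otherwise; a clause set is a finite set of clauses. For a clause set $B$, $f(B)=\bigvee_{L\in B}\bigwedge L$ (empty conjunction $=\top$, empty disjunction $=\bot$); $B$ is a clause set for $\alpha$ if $f(B)$ is Boolean equivalent to $\alpha$. A basic implication is $\lambda_1\wedge\dots\wedge\lambda_n\Rightarrow_d\bigvee_{i=1}^l\bigwedge_{j=1}^{k_i}\mu_{ij}$ with $n\ge1$, $l\ge0$, $k_i\ge1$, where $\{\lambda_1,\dots,\lambda_n\}$ and all $\{\mu_{i1},\dots,\mu_{ik_i}\}$ are consistent clauses; a basic theory is a set of basic implications. A proof forest is a finite directed forest (each component a rooted tree, edges directed from father to child) with a weight in $\mathbb R^+$ on each edge, each node labelled by a clause or by the symbol $\divideontimes$ (nodes identified with labels; nodes not labelled $\divideontimes$ are proper). A branch is a maximal root-to-leaf path; its length is $0$ if it contains $\divideontimes$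 and otherwise the sum of its edge weights; the length of the forest is the maximum length of its branches. A forest proof of $\zeta\Rightarrow_r\eta$ from a basic theory $\mathcal T$ is a proof forest such that: (T1) there is a clause set $B_\zeta$ for $\zeta$ such that each clause of $B_\zeta$ has a root that is a subset of it; (T2) there is a clause set $B_\eta$ for $\eta$ such that every terminal clause includes some clause of $B_\eta$; (T3) the length of the forest is at most $r$; (T4) for every non-terminal clause $L$, all edges from $L$ have the same weight $c$, and one of: (A) $c=0$ and $\mathcal T$ contains a basic implication $\lambda_1\wedge\dots\wedge\lambda_n\Rightarrow_0\bigvee_{i=1}^l\bigwedge_j\mu_{ij}$ with $\{\lambda_1,\dots,\lambda_n\}\subseteq L$ such that for each $i$ some child of $L$ is a clause $L'\subseteq\{\mu_{i1},\dots,\mu_{ik_i}\}\cup L$; (B) $c>0$ and $\mathcal T$ contains a basic implication $\lambda_1\wedge\dots\wedge\lambda_n\Rightarrow_c\bigvee_{i=1}^l\bigwedge_j\mu_{ij}$ with $\{\lambda_1,\dots,\lambda_n\}\subseteq L$ such that for each $i$ some child of $L$ is a clause $L'\subseteq\{\mu_{i1},\dots,\mu_{ik_i}\}$; (C) $c=0$, $L$ is inconsistent and $\divideontimes$ is the only child of $L$; (D) $c=0$ and for some variable $\phi$ (the splitting variable), $L$ has exactly two children, one consisting of $\phi$ together with a subset of $L$, the other of $\neg\phi$ together with a subset of $L$. Unused literal: a literal $\lambda$ contained in a non-terminal clause $L$ of a forest proof is unused in $L$ if one of the following holds: (1) case (A) or (B) applies at $L$, $\lambda$ is not among the $\lambda_1,\dots,\lambda_n$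 of the used basic implication, and whenever $\lambda$ is contained in the child of $L$ associated with index $i\in\{1,\dots,l\}$, $\lambda$ is one of $\mu_{i1},\dots,\mu_{ik_i}$; (2) case (C) applies at $L$ and $L\setminus\{\lambda\}$ is still inconsistent; (3) case (D) applies at $L$ and $\lambda$ is contained in no child of $L$. -}

module Defs where

open import Data.Nat using (ℕ)
open import Data.Bool using (Bool; true; false; _∧_; _∨_; not)
open import Data.Fin using (Fin)
open import Data.List using (List; []; _∷_; length; lookup)
open import Data.List.Membership.Propositional using (_∈_; _∉_)
open import Data.Product using (Σ; ∃; _×_; _,_; proj₁; proj₂)
open import Data.Sum using (_⊎_)
open import Data.Empty using (⊥)
open import Relation.Nullary using (¬_)
open import Relation.Binary.PropositionalEquality using (_≡_; _≢_)
open import Algebra.Structures using (IsCommutativeRing)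
open import Relation.Binary.Structures using (IsTotalOrder)

-- The real numbers, given axiomatically as a (Dedekind-)complete
-- ordered field (agda-stdlib has no real numbers).  All such structures
-- are isomorphic, so quantifying over them is quantifying over ℝ.

record Reals : Set₁ where
  infixl 6 _+_
  infixl 7 _*_
  infix 4 _≤_
  field
    Carrier : Set
    0ℝ 1ℝ   : Carrier
    _+_ _*_ : Carrier → Carrier → Carrier
    -_      : Carrier → Carrier
    _≤_     : Carrier → Carrier → Set
    isCommutativeRing : IsCommutativeRing _≡_ _+_ _*_ -_ 0ℝ 1ℝ
    0≢1     : 0ℝ ≢ 1ℝ
    inverse : ∀ x → x ≢ 0ℝ → ∃ λ y → x * y ≡ 1ℝ
    isTotalOrder : IsTotalOrder _≡_ _≤_
    +-monoˡ : ∀ {x y} z → x ≤ y → x + z ≤ y + z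
    *-nonneg : ∀ {x y} → 0ℝ ≤ x → 0ℝ ≤ y → 0ℝ ≤ x * y
    complete : (S : Carrier → Set) → ∃ S →
               (∃ λ b → ∀ x → S x → x ≤ b) →
               ∃ λ s → (∀ x → S x → x ≤ s) ×
                       (∀ b → (∀ x → S x → x ≤ b) → s ≤ b)

  _<_ : Carrier → Carrier → Set
  x < y = x ≤ y × x ≢ y

data Formula : Set where
  var  : ℕ → Formula
  ⊥f ⊤f : Formula
  _∧f_ _∨f_ : Formula → Formula → Formula
  ¬f_  : Formula → Formula

eval : (ℕ → Bool) → Formula → Bool
eval v (var n)   = v n
eval v ⊥f        = false
eval v ⊤f        = true
eval v (α ∧f β)  = eval v α ∧ eval v β
eval v (α ∨f β)  = eval v α ∨ eval v β
eval v (¬f α)    = not (eval v α)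

_⇒f_ : Formula → Formula → Formula
α ⇒f β = (¬f α) ∨f β

Tautology : Formula → Set
Tautology α = ∀ (v : ℕ → Bool) → eval v α ≡ true

BoolEquiv : Formula → Formula → Set
BoolEquiv α β = Tautology (α ⇒f β) × Tautology (β ⇒f α)

-- Literals, clauses (finite sets, represented by lists), clause sets

data Literal : Set where
  pos : ℕ → Literal
  neg : ℕ → Literal

Clause : Set
Clause = List Literal

ClauseSet : Set
ClauseSet = List Clause

_⊆_ : Clause → Clause → Set
L ⊆ M = ∀ x → x ∈ L → x ∈ M

Inconsistent : Clause → Set
Inconsistent L = ∃ λ φ → pos φ ∈ L × neg φ ∈ L

Consistent : Clause → Set
Consistent L = ¬ Inconsistent L

litF : Literal → Formula
litF (pos φ) = var φ
litF (neg φ) = ¬f var φ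

conj : Clause → Formula
conj []       = ⊤f
conj (x ∷ xs) = litF x ∧f conj xs

disj : List Formula → Formula
disj []       = ⊥f
disj (x ∷ xs) = x ∨f disj xs

f : ClauseSet → Formula
f []       = ⊥f
f (L ∷ Ls) = conj L ∨f f Ls

ClauseSetFor : ClauseSet → Formula → Set
ClauseSetFor B α = BoolEquiv (f B) α

NonEmpty : {A : Set} → List A → Set
NonEmpty xs = xs ≢ []

module WithReals (R : Reals) where
  open Reals R

  ℝ⁺ : Set
  ℝ⁺ = Σ Carrier (0ℝ ≤_)

  -- basic implication  λ₁ ∧ … ∧ λₙ ⇒_d ⋁ᵢ ⋀ⱼ μᵢⱼ
  record BasicImp : Set where
    constructor basic
    field
      lhs      : Clause
      grade    : ℝ⁺
      rhs      : List Clause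
      lhs-ne   : NonEmpty lhs
      lhs-cons : Consistent lhs
      rhs-ne   : ∀ M → M ∈ rhs → NonEmpty M
      rhs-cons : ∀ M → M ∈ rhs → Consistent M
  open BasicImp public

  BasicTheory : Set₁
  BasicTheory = BasicImp → Set

  data Label : Set where
    cl   : Clause → Label
    star : Label

  isStar : Label → Bool
  isStar (cl _) = false
  isStar star   = true

  data Tree : Set where
    node : Label → List (ℝ⁺ × Tree) → Tree

  Forest : Set
  Forest = List Tree

  label : Tree → Label
  label (node ℓ _) = ℓ

  data Sub (n : Tree) : Tree → Set where
    here  : Sub n n
    there : ∀ {ℓ ch w t} → (w , t) ∈ ch → Sub n t → Sub n (node ℓ ch)

  NodeIn : Forest → Tree → Set
  NodeIn F n = ∃ λ t → t ∈ F × Sub n t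

  -- a root-to-leaf branch of t: whether it contains ⋇, and its weight sum
  data Branch : Tree → Bool → Carrier → Set where
    leaf : ∀ {ℓ} → Branch (node ℓ []) (isStar ℓ) 0ℝ
    step : ∀ {ℓ ch w t s x} → (w , t) ∈ ch → Branch t s x →
           Branch (node ℓ ch) (isStar ℓ ∨ s) (proj₁ w + x)

  branchLength : Bool → Carrier → Carrier
  branchLength true  _ = 0ℝ
  branchLength false x = x

  childAt : (ch : List (ℝ⁺ × Tree)) → Fin (length ch) → Tree
  childAt ch j = proj₂ (lookup ch j)

  weightAt : (ch : List (ℝ⁺ × Tree)) → Fin (length ch) → Carrier
  weightAt ch j = proj₁ (proj₁ (lookup ch j))

  ClauseChildIn : Tree → Clause → Set
  ClauseChildIn t M = ∃ λ L' → label t ≡ cl L' × L' ⊆ M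

  LitPlusSubset : Tree → Literal → Clause → Set
  LitPlusSubset t μ L = ∃ λ L' → label t ≡ cl L' × μ ∈ L' ×
                          (∀ x → x ∈ L' → x ≡ μ ⊎ x ∈ L)

  LitIn : Literal → Tree → Set
  LitIn λ' t = ∃ λ L' → label t ≡ cl L' × λ' ∈ L'

  _++c_ : Clause → Clause → Clause
  []       ++c M = M
  (x ∷ xs) ++c M = x ∷ (xs ++c M)

  -- the justification of a non-terminal clause L with edges ch (cases of T4);
  -- in (A),(B) 'assoc i' is the child associated with index i
  data Just (T : BasicTheory) (L : Clause) (ch : List (ℝ⁺ × Tree)) : Set where
    caseA : (b : BasicImp) → T b → proj₁ (grade b) ≡ 0ℝ → lhs b ⊆ L →
            (∀ j → weightAt ch j ≡ 0ℝ) →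
            (assoc : Fin (length (rhs b)) → Fin (length ch)) →
            (∀ i → ClauseChildIn (childAt ch (assoc i)) (lookup (rhs b) i ++c L)) →
            Just T L ch
    caseB : (b : BasicImp) → T b → 0ℝ < proj₁ (grade b) → lhs b ⊆ L →
            (∀ j → weightAt ch j ≡ proj₁ (grade b)) →
            (assoc : Fin (length (rhs b)) → Fin (length ch)) →
            (∀ i → ClauseChildIn (childAt ch (assoc i)) (lookup (rhs b) i)) →
            Just T L ch
    caseC : Inconsistent L → (w : ℝ⁺) (t : Tree) → ch ≡ (w , t) ∷ [] →
            proj₁ w ≡ 0ℝ → label t ≡ star →
            Just T L ch
    caseD : (φ : ℕ) (w₁ w₂ : ℝ⁺) (t₁ t₂ : Tree) → ch ≡ (w₁ , t₁) ∷ (w₂ , t₂) ∷ [] →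
            proj₁ w₁ ≡ 0ℝ → proj₁ w₂ ≡ 0ℝ →
            (LitPlusSubset t₁ (pos φ) L × LitPlusSubset t₂ (neg φ) L) ⊎
            (LitPlusSubset t₁ (neg φ) L × LitPlusSubset t₂ (pos φ) L) →
            Just T L ch

  -- forest proof of ζ ⇒_r η from T (with the justifications of T4 as data)
  record ForestProof (T : BasicTheory) (ζ : Formula) (r : ℝ⁺) (η : Formula) : Set where
    field
      forest : Forest
      T1 : ∃ λ B → ClauseSetFor B ζ ×
             (∀ C → C ∈ B → ∃ λ t → t ∈ forest × ClauseChildIn t C)
      T2 : ∃ λ B → ClauseSetFor B η ×
             (∀ L → NodeIn forest (node (cl L) []) → ∃ λ C → C ∈ B × C ⊆ L)
      T3 : ∀ t → t ∈ forest → ∀ s x → Branch t s x → branchLength s x ≤ proj₁ r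
      just : ∀ {L ch} → NodeIn forest (node (cl L) ch) → NonEmpty ch → Just T L ch

  Unused : ∀ {T L ch} → Literal → Just T L ch → Set
  Unused {L = L} {ch} λ' (caseA b _ _ _ _ assoc _) =
    λ' ∉ lhs b × (∀ i → LitIn λ' (childAt ch (assoc i)) → λ' ∈ lookup (rhs b) i)
  Unused {L = L} {ch} λ' (caseB b _ _ _ _ assoc _) =
    λ' ∉ lhs b × (∀ i → LitIn λ' (childAt ch (assoc i)) → λ' ∈ lookup (rhs b) i)
  Unused {L = L} λ' (caseC _ _ _ _ _ _) =
    ∃ λ φ → pos φ ∈ L × pos φ ≢ λ' × neg φ ∈ L × neg φ ≢ λ'
  Unused {ch = ch} λ' (caseD _ _ _ _ _ _ _ _ _) =
    ∀ w t → (w , t) ∈ ch → ¬ LitIn λ' t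

  NoUnusedLiterals : ∀ {T ζ r η} → ForestProof T ζ r η → Set
  NoUnusedLiterals P =
    ∀ {L ch} (p : NodeIn (ForestProof.forest P) (node (cl L) ch)) (ne : NonEmpty ch) →
    ∀ λ' → λ' ∈ L → ¬ Unused λ' (ForestProof.just P p ne)

module Submission where

-- Every tree of the forest is normalised bottom-up.  After its children
-- have been normalised, a proper inner node labelled L is rebuilt
-- according to its justification:
--   (A),(B)  the literals unused with respect to the basic implication and
--            the normalised children are deleted from L;
--   (C)      the node becomes {φ, ¬φ} with the single child ⋇;
--   (D)      if a normalised child lacks its splitting literal, the node is
--            replaced by that child; otherwise L is cut down to the literals
--            occurring in one of the two children.
-- The result t' of normalising t "refines" t: t' is clean (no proper node
-- has an unused literal), the root clause only shrinks, every terminal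
-- clause of t' is a terminal clause of t, and every branch of t' contains ⋇
-- or has the length of a ⋇-free branch of t.  Conditions (T1)-(T4) are
-- inherited by any forest refining the original one, which gives the lemma.

open import Defs
open import Data.Product using (Σ; ∃; ∃₂; _×_; _,_; proj₁; proj₂)
open import Data.Sum using (_⊎_; inj₁; inj₂; [_,_]′)
open import Data.Empty using (⊥-elim)
open import Data.Nat using (ℕ) renaming (_≟_ to _≟ℕ_)
open import Data.Bool using (true; false)
open import Data.Fin using (Fin; zero; suc)
open import Data.List using (List; []; _∷_; _++_; length; lookup; filter)
open import Data.List.Relation.Unary.Any using (here; there)
open import Data.List.Relation.Unary.Any.Properties using (mapWith∈⁺; mapWith∈⁻)
open import Data.List.Membership.Propositional using (_∈_; _∉_; mapWith∈)
open import Data.List.Membership.Propositional.Properties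
  using (∈-filter⁺; ∈-filter⁻; ∈-++⁺ˡ; ∈-++⁺ʳ; ∈-++⁻)
open import Relation.Nullary using (¬_; Dec; yes; no)
open import Relation.Nullary.Decidable using (map′; ¬?; _×-dec_; _⊎-dec_; _→-dec_)
open import Relation.Unary using (Decidable)
open import Relation.Binary.PropositionalEquality using (_≡_; refl; sym; trans; cong; subst)
open import Relation.Binary.Definitions using (DecidableEquality)
open import Data.Fin.Properties using (all?)
open import Algebra.Structures using (IsCommutativeRing)
open import Relation.Binary.Structures using (IsTotalOrder)

_≟ₗ_ : DecidableEquality Literal
pos m ≟ₗ pos n = map′ (cong pos) (λ { refl → refl }) (m ≟ℕ n)
pos m ≟ₗ neg n = no λ ()
neg m ≟ₗ pos n = no λ ()
neg m ≟ₗ neg n = map′ (cong neg) (λ { refl → refl }) (m ≟ℕ n)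

open import Data.List.Membership.DecPropositional _≟ₗ_ using (_∈?_)

module Pruning (R : Reals) (T : WithReals.BasicTheory R) where
  open Reals R
  open WithReals R
  open IsCommutativeRing isCommutativeRing using (+-identityˡ)
  open IsTotalOrder isTotalOrder using () renaming (refl to ≤-refl)

  ++c≡++ : (M L : Clause) → M ++c L ≡ M ++ L
  ++c≡++ []      L = refl
  ++c≡++ (x ∷ M) L = cong (x ∷_) (++c≡++ M L)

  ∈-++c⁻ : ∀ {x} (M L : Clause) → x ∈ M ++c L → x ∈ M ⊎ x ∈ L
  ∈-++c⁻ M L x∈ = ∈-++⁻ M (subst (_ ∈_) (++c≡++ M L) x∈)

  ∈-++c⁺ : ∀ {x} (M L : Clause) → x ∈ M ⊎ x ∈ L → x ∈ M ++c L
  ∈-++c⁺ M L x∈ = subst (_ ∈_) (sym (++c≡++ M L)) ([ ∈-++⁺ˡ , ∈-++⁺ʳ M ]′ x∈)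

  litIn? : ∀ x t → Dec (LitIn x t)
  litIn? x (node star _)   = no λ { (_ , () , _) }
  litIn? x (node (cl K) _) = map′ (λ x∈K → K , refl , x∈K) (λ { (_ , refl , x∈K) → x∈K }) (x ∈? K)


  NoUnused : ∀ {L ch} → Just T L ch → Set
  NoUnused {L} J = ∀ x → x ∈ L → ¬ Unused x J

  data Clean : Tree → Set where
    clean-leaf : ∀ ℓ → Clean (node ℓ [])
    clean-node : ∀ {L ch} → NonEmpty ch → (J : Just T L ch) → NoUnused J →
                 (∀ {w t} → (w , t) ∈ ch → Clean t) → Clean (node (cl L) ch)

  clean-just : ∀ {t L ch} → Clean t → Sub (node (cl L) ch) t → NonEmpty ch →
               Σ (Just T L ch) NoUnused
  clean-just (clean-leaf _)           here        ne = ⊥-elim (ne refl)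
  clean-just (clean-node _ J unused _) here       ne = J , unused
  clean-just (clean-leaf _)           (there () _) ne
  clean-just (clean-node _ _ _ cs)    (there m s) ne = clean-just (cs m) s ne


  record Refines (t t' : Tree) : Set where
    field
      clean     : Clean t'
      shrinks   : ∀ {K} → label t ≡ cl K → ClauseChildIn t' K
      terminals : ∀ K → Sub (node (cl K) []) t' → Sub (node (cl K) []) t
      branches  : ∀ s x → Branch t' s x → s ≡ true ⊎ Branch t false x
  open Refines

  refine-child : ∀ {t t' M} → Refines t t' → ClauseChildIn t M → ClauseChildIn t' M
  refine-child r (K , eK , K⊆M) with shrinks r eK
  ... | K' , eK' , K'⊆K = K' , eK' , λ x x∈ → K⊆M x (K'⊆K x x∈)

  data RefinesAll : List (ℝ⁺ × Tree) → List (ℝ⁺ × Tree) → Set where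
    []  : RefinesAll [] []
    _∷_ : ∀ {w t t' ch ch'} → Refines t t' → RefinesAll ch ch' →
          RefinesAll ((w , t) ∷ ch) ((w , t') ∷ ch')

  forward : ∀ {ch ch'} → RefinesAll ch ch' → Fin (length ch) → Fin (length ch')
  forward (_ ∷ _)  zero    = zero
  forward (_ ∷ rs) (suc j) = suc (forward rs j)

  forward-refines : ∀ {ch ch'} (rs : RefinesAll ch ch') j →
                    Refines (childAt ch j) (childAt ch' (forward rs j))
  forward-refines (r ∷ _)  zero    = r
  forward-refines (_ ∷ rs) (suc j) = forward-refines rs j

  backward : ∀ {ch ch' w t'} → RefinesAll ch ch' → (w , t') ∈ ch' →
             ∃ λ t → (w , t) ∈ ch × Refines t t'
  backward (r ∷ _)  (here refl) = _ , here refl , r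
  backward (_ ∷ rs) (there m) with backward rs m
  ... | t , m' , r = t , there m' , r

  same-weights : ∀ {ch ch' c} → RefinesAll ch ch' →
                 (∀ j → weightAt ch j ≡ c) → ∀ j → weightAt ch' j ≡ c
  same-weights (_ ∷ _)  wts zero    = wts zero
  same-weights (_ ∷ rs) wts (suc j) = same-weights rs (λ i → wts (suc i)) j

  nonempty-refined : ∀ {ch ch'} → RefinesAll ch ch' → NonEmpty ch → NonEmpty ch'
  nonempty-refined [] ne refl = ne refl

  refine-node : ∀ {L L' ch ch'} → RefinesAll ch ch' → NonEmpty ch →
                (J : Just T L' ch') → NoUnused J → L' ⊆ L →
                Refines (node (cl L) ch) (node (cl L') ch')
  refine-node {L} {L'} {ch} {ch'} rs ne J unused L'⊆L = record
    { clean = clean-node ne' J unused (λ m → clean (proj₂ (proj₂ (backward rs m))))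
    ; shrinks = λ { refl → _ , refl , L'⊆L }
    ; terminals = terminals'
    ; branches = branches' }
    where
    ne' : NonEmpty ch'
    ne' = nonempty-refined rs ne
    terminals' : ∀ K → Sub (node (cl K) []) (node (cl L') ch') → Sub (node (cl K) []) (node (cl L) ch)
    terminals' K here = ⊥-elim (ne' refl)
    terminals' K (there m s) with backward rs m
    ... | _ , m' , r = there m' (terminals r K s)
    branches' : ∀ s x → Branch (node (cl L') ch') s x → s ≡ true ⊎ Branch (node (cl L) ch) false x
    branches' _ _ leaf = ⊥-elim (ne' refl)
    branches' _ _ (step m b) with backward rs m
    ... | _ , m' , r with branches r _ _ b
    ... | inj₁ e  = inj₁ e
    ... | inj₂ b' = inj₂ (step m' b')

  collapse : ∀ {L ch w t t'} → (w , t) ∈ ch → proj₁ w ≡ 0ℝ → Refines t t' →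
             ClauseChildIn t' L → Refines (node (cl L) ch) t'
  collapse {L} {ch} {w} {t' = t'} m w≡0 r t'⊆L = record
    { clean = clean r
    ; shrinks = λ { refl → t'⊆L }
    ; terminals = λ K s → there m (terminals r K s)
    ; branches = branches' }
    where
    branches' : ∀ s x → Branch t' s x → s ≡ true ⊎ Branch (node (cl L) ch) false x
    branches' s x b with branches r s x b
    ... | inj₁ e  = inj₁ e
    ... | inj₂ b' = inj₂ (subst (Branch (node (cl L) ch) false) weightless (step m b'))
      where
      weightless : proj₁ w + x ≡ x
      weightless = trans (cong (_+ x) w≡0) (+-identityˡ x)

  refine-leaf : ∀ L → Refines (node (cl L) []) (node (cl L) [])
  refine-leaf L = record
    { clean = clean-leaf (cl L) ; shrinks = λ { refl → L , refl , λ _ x∈ → x∈ }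
    ; terminals = λ _ s → s ; branches = λ { _ _ leaf → inj₂ leaf ; _ _ (step () _) } }

  refine-star : ∀ ch → Refines (node star ch) (node star [])
  refine-star ch = record
    { clean = clean-leaf star ; shrinks = λ ()
    ; terminals = λ { _ (there () _) } ; branches = λ { _ _ leaf → inj₁ refl ; _ _ (step () _) } }


  -- (A),(B): the literals unused with respect to the basic implication b and
  -- the associated (already refined) children are dropped from L.  Dropping
  -- them does not change which of the remaining literals are unused.
  module DropUnused (b : BasicImp) (L : Clause) (ch : List (ℝ⁺ × Tree))
                    (assoc : Fin (length (rhs b)) → Fin (length ch)) where

    RuleUnused : Literal → Set
    RuleUnused x = x ∉ lhs b × (∀ i → LitIn x (childAt ch (assoc i)) → x ∈ lookup (rhs b) i)

    ruleUnused? : Decidable RuleUnused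
    ruleUnused? x = ¬? (x ∈? lhs b) ×-dec
                    all? (λ i → litIn? x (childAt ch (assoc i)) →-dec (x ∈? lookup (rhs b) i))

    used? : Decidable (λ x → ¬ RuleUnused x)
    used? x = ¬? (ruleUnused? x)

    kept : Clause
    kept = filter used? L

    kept⊆L : kept ⊆ L
    kept⊆L x x∈ = proj₁ (∈-filter⁻ used? {xs = L} x∈)

    kept-used : ∀ x → x ∈ kept → ¬ RuleUnused x
    kept-used x x∈ = proj₂ (∈-filter⁻ used? {xs = L} x∈)

    lhs⊆kept : lhs b ⊆ L → lhs b ⊆ kept
    lhs⊆kept lhs⊆L x x∈ = ∈-filter⁺ used? (lhs⊆L x x∈) (λ u → proj₁ u x∈)

    -- In case (A) the children may reuse literals of L; a reused literal is
    -- either kept or, being unused, belongs to the implication's disjunct.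
    child-kept : ∀ i → ClauseChildIn (childAt ch (assoc i)) (lookup (rhs b) i ++c L) →
                 ClauseChildIn (childAt ch (assoc i)) (lookup (rhs b) i ++c kept)
    child-kept i (K , eK , K⊆) = K , eK , λ x x∈K → ∈-++c⁺ μ kept (place x x∈K)
      where
      μ : Clause
      μ = lookup (rhs b) i
      place : ∀ x → x ∈ K → x ∈ μ ⊎ x ∈ kept
      place x x∈K with ∈-++c⁻ μ L (K⊆ x x∈K)
      ... | inj₁ x∈μ = inj₁ x∈μ
      ... | inj₂ x∈L with ruleUnused? x
      ...   | yes u  = inj₁ (proj₂ u i (K , eK , x∈K))
      ...   | no ¬u  = inj₂ (∈-filter⁺ used? x∈L ¬u)

  module ComplementaryPair (φ : ℕ) where
    pair : Clause
    pair = pos φ ∷ neg φ ∷ []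

    to-star : List (ℝ⁺ × Tree)
    to-star = ((0ℝ , ≤-refl) , node star []) ∷ []

    J : Just T pair to-star
    J = caseC (φ , here refl , there (here refl)) _ _ refl refl refl

    pair-used : NoUnused J
    pair-used _ (here refl)         (_ , here refl , p≢ , _)              = p≢ refl
    pair-used _ (there (here refl)) (_ , here refl , _ , there (here refl) , n≢) = n≢ refl
    pair-used _ _ (_ , here refl , _ , here () , _)
    pair-used _ _ (_ , here refl , _ , there (there ()) , _)
    pair-used _ _ (_ , there (here ()) , _)
    pair-used _ _ (_ , there (there ()) , _)

  refine-inconsistent : ∀ {L ch} → Inconsistent L →
                        Σ Tree (Refines (node (cl L) ch))
  refine-inconsistent {L} {ch} (φ , pφ∈ , nφ∈) = node (cl pair) to-star , record
    { clean = clean-node (λ ()) J pair-used λ { (here refl) → clean-leaf star }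
    ; shrinks = λ { refl → pair , refl , pair⊆L }
    ; terminals = λ { _ (there (here refl) (there () _)) }
    ; branches = λ { _ _ (step (here refl) leaf) → inj₁ refl
                   ; _ _ (step (here refl) (step () _)) } }
    where
    open ComplementaryPair φ
    pair⊆L : pair ⊆ L
    pair⊆L _ (here refl)         = pφ∈
    pair⊆L _ (there (here refl)) = nφ∈

  SplitOn : ℕ → Tree → Tree → Clause → Set
  SplitOn φ t₁ t₂ L = (LitPlusSubset t₁ (pos φ) L × LitPlusSubset t₂ (neg φ) L) ⊎
                      (LitPlusSubset t₁ (neg φ) L × LitPlusSubset t₂ (pos φ) L)

  pivots : ∀ {φ t₁ t₂ L} → SplitOn φ t₁ t₂ L →
           ∃₂ λ a b → LitPlusSubset t₁ a L × LitPlusSubset t₂ b L ×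
                      (∀ u₁ u₂ {L'} → LitPlusSubset u₁ a L' → LitPlusSubset u₂ b L' →
                                      SplitOn φ u₁ u₂ L')
  pivots (inj₁ (p₁ , p₂)) = _ , _ , p₁ , p₂ , λ _ _ q₁ q₂ → inj₁ (q₁ , q₂)
  pivots (inj₂ (p₁ , p₂)) = _ , _ , p₁ , p₂ , λ _ _ q₁ q₂ → inj₂ (q₁ , q₂)

  pivot-child : ∀ {t a L} → LitPlusSubset t a L → ClauseChildIn t (a ∷ L)
  pivot-child (K , eK , _ , K⊆) = K , eK , λ x x∈ → lift (K⊆ x x∈)
    where
    lift : ∀ {x a L} → x ≡ a ⊎ x ∈ L → x ∈ a ∷ L
    lift (inj₁ refl) = here refl
    lift (inj₂ x∈L)  = there x∈L

  without-pivot : ∀ {a K L} → K ⊆ (a ∷ L) → a ∉ K → K ⊆ L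
  without-pivot K⊆ a∉ x x∈ with K⊆ x x∈
  ... | here refl = ⊥-elim (a∉ x∈)
  ... | there x∈L = x∈L

  with-pivot : ∀ {t a K L L'} → label t ≡ cl K → K ⊆ (a ∷ L) → a ∈ K →
               (∀ x → x ∈ K → x ∈ L → x ∈ L') → LitPlusSubset t a L'
  with-pivot {a = a} {K} {L} {L'} eK K⊆ a∈ retain = K , eK , a∈ , λ x x∈ → place x x∈ (K⊆ x x∈)
    where
    place : ∀ x → x ∈ K → x ∈ a ∷ L → x ≡ a ⊎ x ∈ L'
    place x _   (here e)    = inj₁ e
    place x x∈K (there x∈L) = inj₂ (retain x x∈K x∈L)

  refine-split : ∀ {L φ w₁ w₂ t₁ t₂ t₁' t₂'} → Refines t₁ t₁' → Refines t₂ t₂' →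
                 ∀ a b → proj₁ w₁ ≡ 0ℝ → proj₁ w₂ ≡ 0ℝ →
                 ClauseChildIn t₁' (a ∷ L) → ClauseChildIn t₂' (b ∷ L) →
                 (∀ u₁ u₂ {L'} → LitPlusSubset u₁ a L' → LitPlusSubset u₂ b L' → SplitOn φ u₁ u₂ L') →
                 Σ Tree (Refines (node (cl L) ((w₁ , t₁) ∷ (w₂ , t₂) ∷ [])))
  refine-split _ _ a b _ _ (K₁ , _ , _) (K₂ , _ , _) _ with a ∈? K₁ | b ∈? K₂
  refine-split {t₁' = t₁'} r₁ _ a b w₁≡0 _ (K₁ , e₁ , K₁⊆) _ _ | no a∉ | _ =
    t₁' , collapse (here refl) w₁≡0 r₁ (K₁ , e₁ , without-pivot K₁⊆ a∉)
  refine-split {t₂' = t₂'} _ r₂ a b _ w₂≡0 _ (K₂ , e₂ , K₂⊆) _ | yes _ | no b∉ =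
    t₂' , collapse (there (here refl)) w₂≡0 r₂ (K₂ , e₂ , without-pivot K₂⊆ b∉)
  refine-split {L} {φ} {w₁} {w₂} {t₁' = t₁'} {t₂'} r₁ r₂ a b w₁≡0 w₂≡0
               (K₁ , e₁ , K₁⊆) (K₂ , e₂ , K₂⊆) resplit | yes a∈ | yes b∈ =
    node (cl L') ch' , refine-node (r₁ ∷ r₂ ∷ []) (λ ()) J used L'⊆L
    where
    occurs? : Decidable (λ x → x ∈ K₁ ⊎ x ∈ K₂)
    occurs? x = (x ∈? K₁) ⊎-dec (x ∈? K₂)
    L' : Clause
    L' = filter occurs? L
    L'⊆L : L' ⊆ L
    L'⊆L x x∈ = proj₁ (∈-filter⁻ occurs? {xs = L} x∈)
    ch' : List (ℝ⁺ × Tree)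
    ch' = (w₁ , t₁') ∷ (w₂ , t₂') ∷ []
    J : Just T L' ch'
    J = caseD φ w₁ w₂ t₁' t₂' refl w₁≡0 w₂≡0
          (resplit t₁' t₂' (with-pivot {t₁'} e₁ K₁⊆ a∈ (λ x x∈ x∈L → ∈-filter⁺ occurs? x∈L (inj₁ x∈)))
                   (with-pivot {t₂'} e₂ K₂⊆ b∈ (λ x x∈ x∈L → ∈-filter⁺ occurs? x∈L (inj₂ x∈))))
    used : NoUnused J
    used x x∈ absent with proj₂ (∈-filter⁻ occurs? {xs = L} x∈)
    ... | inj₁ x∈K₁ = absent w₁ t₁' (here refl) (K₁ , e₁ , x∈K₁)
    ... | inj₂ x∈K₂ = absent w₂ t₂' (there (here refl)) (K₂ , e₂ , x∈K₂)

  refine-justified : ∀ {L ch ch'} → NonEmpty ch → Just T L ch → RefinesAll ch ch' →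
                     Σ Tree (Refines (node (cl L) ch))
  refine-justified {L} {ch} {ch'} ne (caseA b b∈T g≡0 lhs⊆L wts assoc chs) rs =
    node (cl kept) ch' , refine-node rs ne J kept-used kept⊆L
    where
    open DropUnused b L ch' (λ i → forward rs (assoc i))
    J : Just T kept ch'
    J = caseA b b∈T g≡0 (lhs⊆kept lhs⊆L) (same-weights rs wts) _
              (λ i → child-kept i (refine-child (forward-refines rs (assoc i)) (chs i)))
  refine-justified {L} {ch} {ch'} ne (caseB b b∈T g>0 lhs⊆L wts assoc chs) rs =
    node (cl kept) ch' , refine-node rs ne J kept-used kept⊆L
    where
    open DropUnused b L ch' (λ i → forward rs (assoc i))
    J : Just T kept ch'
    J = caseB b b∈T g>0 (lhs⊆kept lhs⊆L) (same-weights rs wts) _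
              (λ i → refine-child (forward-refines rs (assoc i)) (chs i))
  refine-justified _ (caseC incons _ _ _ _ _) _ = refine-inconsistent incons
  refine-justified _ (caseD φ _ _ t₁ t₂ refl w₁≡0 w₂≡0 split) (r₁ ∷ r₂ ∷ [])
    with pivots {t₁ = t₁} {t₂} split
  ... | a , b , p₁ , p₂ , resplit =
    refine-split r₁ r₂ a b w₁≡0 w₂≡0 (refine-child r₁ (pivot-child {t₁} p₁))
                 (refine-child r₂ (pivot-child {t₂} p₂)) resplit


  Justified : Tree → Set
  Justified t = ∀ {L ch} → Sub (node (cl L) ch) t → NonEmpty ch → Just T L ch

  mutual
    normalise : ∀ t → Justified t → Σ Tree (Refines t)
    normalise (node star ch)         _ = node star [] , refine-star ch
    normalise (node (cl L) [])       _ = node (cl L) [] , refine-leaf L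
    normalise (node (cl L) (c ∷ ch)) j =
      refine-justified (λ ()) (j here (λ ()))
        (proj₂ (normalise-all (c ∷ ch) (λ m s → j (there m s))))

    normalise-all : ∀ ch → (∀ {w t} → (w , t) ∈ ch → Justified t) →
                    Σ (List (ℝ⁺ × Tree)) (RefinesAll ch)
    normalise-all []             _ = [] , []
    normalise-all ((w , t) ∷ ch) j with normalise t (j (here refl)) | normalise-all ch (λ m → j (there m))
    ... | t' , r | ch' , rs = (w , t') ∷ ch' , r ∷ rs

  record RefinesForest (F F' : Forest) : Set where
    field
      covers : ∀ {t}  → t ∈ F   → ∃ λ t' → t' ∈ F' × Refines t t'
      traces : ∀ {t'} → t' ∈ F' → ∃ λ t  → t ∈ F  × Refines t t'
  open RefinesForest

  normalise-forest : ∀ F → (∀ {t} → t ∈ F → Justified t) → ∃ (RefinesForest F)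
  normalise-forest F j = F' , record
    { covers = λ m → _ , mapWith∈⁺ (λ m → proj₁ (N m)) (_ , m , refl) , proj₂ (N m)
    ; traces = λ m' → trace (mapWith∈⁻ F (λ m → proj₁ (N m)) m') }
    where
    N : ∀ {t} → t ∈ F → Σ Tree (Refines t)
    N m = normalise _ (j m)
    F' : Forest
    F' = mapWith∈ F (λ m → proj₁ (N m))
    trace : ∀ {t'} → (∃₂ λ t (m : t ∈ F) → t' ≡ proj₁ (N m)) → ∃ λ t → t ∈ F × Refines t t'
    trace (t , m , refl) = t , m , proj₂ (N m)

  refined-proof : ∀ {ζ r η} (P : ForestProof T ζ r η) {F'} →
                  RefinesForest (ForestProof.forest P) F' →
                  Σ (ForestProof T ζ r η) NoUnusedLiterals
  refined-proof {ζ} {r} {η} P {F'} rf =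
    record { forest = F' ; T1 = T1' ; T2 = T2' ; T3 = T3' ; just = λ p ne → proj₁ (justify p ne) }
    , λ p ne → proj₂ (justify p ne)
    where
    open ForestProof P
    justify : ∀ {L ch} → NodeIn F' (node (cl L) ch) → NonEmpty ch → Σ (Just T L ch) NoUnused
    justify (t' , m' , s) = clean-just (clean (proj₂ (proj₂ (traces rf m')))) s
    T1' : ∃ λ B → ClauseSetFor B ζ × (∀ C → C ∈ B → ∃ λ t → t ∈ F' × ClauseChildIn t C)
    T1' with T1
    ... | B , forB , roots = B , forB , λ C C∈ → root (roots C C∈)
      where
      root : ∀ {C} → (∃ λ t → t ∈ forest × ClauseChildIn t C) → ∃ λ t → t ∈ F' × ClauseChildIn t C
      root (t , m , t⊆C) with covers rf m
      ... | t' , m' , r = t' , m' , refine-child r t⊆C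
    T2' : ∃ λ B → ClauseSetFor B η × (∀ L → NodeIn F' (node (cl L) []) → ∃ λ C → C ∈ B × C ⊆ L)
    T2' with T2
    ... | B , forB , ends = B , forB , λ { L (t' , m' , s) → end L (traces rf m') s }
      where
      end : ∀ L {t'} → (∃ λ t → t ∈ forest × Refines t t') → Sub (node (cl L) []) t' →
            ∃ λ C → C ∈ B × C ⊆ L
      end L (t , m , r) s = ends L (t , m , terminals r L s)
    T3' : ∀ t → t ∈ F' → ∀ s x → Branch t s x → branchLength s x ≤ proj₁ r
    T3' t' m' s x b with traces rf m'
    ... | t , m , ref with s | branches ref s x b
    ...   | true  | _       = proj₂ r
    ...   | false | inj₁ ()
    ...   | false | inj₂ b' = T3 t m false x b'

  remove-unused : ∀ {ζ r η} → ForestProof T ζ r η → Σ (ForestProof T ζ r η) NoUnusedLiterals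
  remove-unused P = refined-proof P (proj₂ (normalise-forest forest λ m s → just (_ , m , s)))
    where open ForestProof P

lemma5p2 : (R : Reals) → let open WithReals R in
           (T : BasicTheory) (ζ : Formula) (r : ℝ⁺) (η : Formula) →
           ForestProof T ζ r η →
           Σ (ForestProof T ζ r η) NoUnusedLiterals
lemma5p2 R T ζ r η = Pruning.remove-unused R T
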